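{- Let $k\geq 2$ be an integer and define $C_{k,j}$, $0\le j\le k-1$, by \[ \frac{(2x)\,\big(x-\tfrac{k-1}{2}+1\big)\big(x-\tfrac{k-1}{2}+2\big)\cdots\big(x-\tfrac{k-1}{2}+k-2\big)}{(k-1)!}=P_k\!\left(x-\frac{k-1}{2}\right)=\frac{1}{(k-1)!}\sum_{j=0}^{k-1} C_{k,j}\,x^j, \] where $P_k(x)=\frac{(2x+k-1)(x+1)\cdots(x+k-2)}{(k-1)!}$. Then $C_{k,j}=B_{k,j}$ for all $0\le j\le k-1$.
   Context: The Stirling numbers of the first kind $s_{n,m}$ ($n\ge 1$, $0\le m\le n$) are defined by $x(x+1)\cdots(x+n-1)=\sum_{m=0}^{n}(-1)^{n+m}s_{n,m}x^m$. For integers $k\ge 2$ and $0\le j\le k-1$, \[ B_{k,j}=\sum_{p=0}^{k-j-1}(-1)^{k+j+1}\binom{j+p}{j}\left(\frac{k-1}{2}\right)^p\left(s_{k,j+p+1}+s_{k-1,j+p}\right). \] For $k=2$ the product $(x+1)\cdots(x+k-2)$ in $P_k$ is empty and equals $1$. -}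

module Defs where

open import Data.Nat as ℕ using (ℕ; zero; suc; _∸_; _!)
open import Data.Nat.Properties using (_!≢0)
open import Data.Nat.Combinatorics using (_C_)
open import Data.Integer as ℤ using (+_)
open import Data.List using (List; []; _∷_; map; foldr; upTo)
open import Data.Rational as ℚ using (ℚ; 0ℚ; 1ℚ; _+_; _*_; -_; _/_)

ℕ→ℚ : ℕ → ℚ
ℕ→ℚ n = + n / 1

_^ℚ_ : ℚ → ℕ → ℚ
q ^ℚ zero = 1ℚ
q ^ℚ suc n = q * (q ^ℚ n)

negOnePow : ℕ → ℚ
negOnePow zero = 1ℚ
negOnePow (suc n) = - negOnePow n

-- Univariate polynomials over ℚ as coefficient lists (constant term first)

Poly : Set
Poly = List ℚ

_+P_ : Poly → Poly → Poly
[] +P q = q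
(a ∷ p) +P [] = a ∷ p
(a ∷ p) +P (b ∷ q) = (a + b) ∷ (p +P q)

scaleP : ℚ → Poly → Poly
scaleP c = map (c *_)

_*P_ : Poly → Poly → Poly
[] *P q = []
(a ∷ p) *P q = scaleP a q +P (0ℚ ∷ (p *P q))

constP : ℚ → Poly
constP c = c ∷ []

X : Poly
X = 0ℚ ∷ 1ℚ ∷ []

prodP : List Poly → Poly
prodP = foldr _*P_ (constP 1ℚ)

compose : Poly → Poly → Poly
compose p q = foldr (λ a acc → constP a +P (q *P acc)) [] p

coeff : Poly → ℕ → ℚ
coeff [] j = 0ℚ
coeff (a ∷ p) zero = a
coeff (a ∷ p) (suc j) = coeff p j

-- Stirling numbers of the first kind, by the defining identity
-- x(x+1)...(x+n-1) = Σ_m (-1)^(n+m) s_{n,m} x^m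

risingPoly : ℕ → Poly
risingPoly n = prodP (map (λ i → constP (ℕ→ℚ i) +P X) (upTo n))

stirling1 : ℕ → ℕ → ℚ
stirling1 n m = negOnePow (n ℕ.+ m) * coeff (risingPoly n) m

Pk : ℕ → Poly
Pk k = scaleP (inv-fact (k ∸ 1))
         ((scaleP (ℕ→ℚ 2) X +P constP (ℕ→ℚ (k ∸ 1)))
           *P prodP (map (λ i → X +P constP (ℕ→ℚ (suc i))) (upTo (k ∸ 2))))
  where
  inv-fact : ℕ → ℚ
  inv-fact n = (+ 1 / (n !)) {{n !≢0}}

half : ℕ → ℚ
half k = + (k ∸ 1) / 2

Ccoef : ℕ → ℕ → ℚ
Ccoef k j = ℕ→ℚ ((k ∸ 1) !) * coeff (compose (Pk k) (X +P constP (- half k))) j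

sumRange : ℕ → (ℕ → ℚ) → ℚ
sumRange n f = foldr (λ p acc → f p + acc) 0ℚ (upTo n)

Bcoef : ℕ → ℕ → ℚ
Bcoef k j = sumRange (k ∸ j) λ p →
  negOnePow (k ℕ.+ j ℕ.+ 1) * ℕ→ℚ ((j ℕ.+ p) C j) * (half k ^ℚ p)
    * (stirling1 k (j ℕ.+ p ℕ.+ 1) + stirling1 (k ∸ 1) (j ℕ.+ p))

{-# OPTIONS --safe #-}
-- Write k = n + 2, G = (x + 1)⋯(x + n) and R_m = x(x + 1)⋯(x + m - 1). Then
-- (k - 1)! P_k = (2x + n + 1) G = (x + n + 1) G + x G, where x (x + n + 1) G = R_k and x G = R_(k-1);
-- so its coefficient of x^m is [x^(m+1)] R_k + [x^m] R_(k-1) = ±(s_(k,m+1) + s_(k-1,m)).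
-- Substituting x - (k - 1)/2 is a Taylor shift: the coefficient of x^j in p(x + c) is
-- Σ_t C(j + t, j) c^t [x^(j+t)] p, by induction on p and Pascal's rule. For c = -(k - 1)/2 the sign
-- (-1)^t of c^t merges with the Stirling signs into the factor (-1)^(k+j+1) of B_(k,j).

module Submission where

open import Defs
open import Data.Nat as ℕ using (ℕ; zero; suc; _≤_; _<_; _∸_; _!; z≤n; s≤s)
import Data.Nat.Properties as ℕP
open import Data.Nat.Tactic.RingSolver using (solve-∀)
open import Data.Nat.Combinatorics using (_C_; nCk+nC[k+1]≡[n+1]C[k+1]; k>n⇒nCk≡0)
import Data.Integer as ℤ
open import Data.Integer using () renaming (+_ to pos)
import Data.Integer.Properties as ℤP
open import Data.List using ([]; _∷_; map; foldr; upTo; applyUpTo)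
open import Data.List.Properties using (map-upTo)
open import Data.Rational using (ℚ; 0ℚ; 1ℚ; _+_; _*_; -_; _/_; toℚᵘ)
import Data.Rational.Properties as ℚP
import Data.Rational.Unnormalised as ℚᵘ
import Data.Rational.Unnormalised.Properties as ℚᵘP
open import Data.Rational.Solver using (module +-*-Solver)
open +-*-Solver using (solve; _:+_; _:*_; :-_; _:=_; con)
open import Function using (id; _∘_)
open import Relation.Binary.PropositionalEquality

toℚᵘ-ℕ→ℚ : ∀ n → toℚᵘ (ℕ→ℚ n) ℚᵘ.≃ ℚᵘ.mkℚᵘ (pos n) 0
toℚᵘ-ℕ→ℚ n = ℚP.toℚᵘ-fromℚᵘ (ℚᵘ.mkℚᵘ (pos n) 0)

ℕ→ℚ-+ : ∀ m n → ℕ→ℚ (m ℕ.+ n) ≡ ℕ→ℚ m + ℕ→ℚ n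
ℕ→ℚ-+ m n = ℚP.toℚᵘ-injective (begin
  toℚᵘ (ℕ→ℚ (m ℕ.+ n))                     ≈⟨ toℚᵘ-ℕ→ℚ (m ℕ.+ n) ⟩
  ℚᵘ.mkℚᵘ (pos (m ℕ.+ n)) 0                 ≈⟨ ℚᵘ.*≡* (cong (ℤ._* pos 1) sum) ⟩
  ℚᵘ.mkℚᵘ (pos m) 0 ℚᵘ.+ ℚᵘ.mkℚᵘ (pos n) 0  ≈⟨ ℚᵘP.+-cong (toℚᵘ-ℕ→ℚ m) (toℚᵘ-ℕ→ℚ n) ⟨
  toℚᵘ (ℕ→ℚ m) ℚᵘ.+ toℚᵘ (ℕ→ℚ n)            ≈⟨ ℚP.toℚᵘ-homo-+ (ℕ→ℚ m) (ℕ→ℚ n) ⟨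
  toℚᵘ (ℕ→ℚ m + ℕ→ℚ n)                      ∎)
  where
  open ℚᵘP.≃-Reasoning
  sum : pos (m ℕ.+ n) ≡ pos m ℤ.* pos 1 ℤ.+ pos n ℤ.* pos 1
  sum = trans (ℤP.pos-+ m n) (sym (cong₂ ℤ._+_ (ℤP.*-identityʳ (pos m)) (ℤP.*-identityʳ (pos n))))

ℕ→ℚ-*-inverse : ∀ n .{{_ : ℕ.NonZero n}} → ℕ→ℚ n * (pos 1 / n) ≡ 1ℚ
ℕ→ℚ-*-inverse (suc d) = ℚP.toℚᵘ-injective (begin
  toℚᵘ (ℕ→ℚ (suc d) * (pos 1 / suc d))
    ≈⟨ ℚP.toℚᵘ-homo-* (ℕ→ℚ (suc d)) (pos 1 / suc d) ⟩
  toℚᵘ (ℕ→ℚ (suc d)) ℚᵘ.* toℚᵘ (pos 1 / suc d)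
    ≈⟨ ℚᵘP.*-cong (toℚᵘ-ℕ→ℚ (suc d)) (ℚP.toℚᵘ-fromℚᵘ (ℚᵘ.mkℚᵘ (pos 1) d)) ⟩
  ℚᵘ.mkℚᵘ (pos (suc d)) 0 ℚᵘ.* ℚᵘ.mkℚᵘ (pos 1) d
    ≈⟨ ℚᵘ.*≡* cross ⟩
  toℚᵘ 1ℚ ∎)
  where
  open ℚᵘP.≃-Reasoning
  cross : (pos (suc d) ℤ.* pos 1) ℤ.* pos 1 ≡ pos 1 ℤ.* pos (1 ℕ.* suc d)
  cross = trans (ℤP.*-identityʳ _) (trans (ℤP.*-identityʳ _)
    (sym (trans (ℤP.*-identityˡ _) (cong pos (ℕP.*-identityˡ (suc d))))))

negOnePow-+ : ∀ m n → negOnePow (m ℕ.+ n) ≡ negOnePow m * negOnePow n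
negOnePow-+ zero    n = sym (ℚP.*-identityˡ (negOnePow n))
negOnePow-+ (suc m) n = trans (cong -_ (negOnePow-+ m n)) (ℚP.neg-distribˡ-* (negOnePow m) (negOnePow n))

negOnePow-square : ∀ n → negOnePow n * negOnePow n ≡ 1ℚ
negOnePow-square zero    = refl
negOnePow-square (suc n) =
  trans (solve 1 (λ x → :- x :* :- x := x :* x) refl (negOnePow n)) (negOnePow-square n)

negOnePow-cancelˡ : ∀ m n → negOnePow m * negOnePow (m ℕ.+ n) ≡ negOnePow n
negOnePow-cancelˡ m n = begin
  negOnePow m * negOnePow (m ℕ.+ n)            ≡⟨ cong (negOnePow m *_) (negOnePow-+ m n) ⟩
  negOnePow m * (negOnePow m * negOnePow n)    ≡⟨ ℚP.*-assoc (negOnePow m) (negOnePow m) (negOnePow n) ⟨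
  negOnePow m * negOnePow m * negOnePow n      ≡⟨ cong (_* negOnePow n) (negOnePow-square m) ⟩
  1ℚ * negOnePow n                             ≡⟨ ℚP.*-identityˡ (negOnePow n) ⟩
  negOnePow n                                  ∎
  where open ≡-Reasoning

negOnePow-suc-suc : ∀ n → negOnePow (suc (suc n)) ≡ negOnePow n
negOnePow-suc-suc n = solve 1 (λ x → :- (:- x) := x) refl (negOnePow n)

-‿^ℚ : ∀ q n → (- q) ^ℚ n ≡ negOnePow n * q ^ℚ n
-‿^ℚ q zero    = refl
-‿^ℚ q (suc n) = trans (cong (- q *_) (-‿^ℚ q n))
  (solve 3 (λ q x y → :- q :* (x :* y) := :- x :* (q :* y)) refl q (negOnePow n) (q ^ℚ n))

Σ< : ℕ → (ℕ → ℚ) → ℚ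
Σ< zero    f = 0ℚ
Σ< (suc n) f = f 0 + Σ< n (f ∘ suc)

sumRange≡Σ< : ∀ n f → sumRange n f ≡ Σ< n f
sumRange≡Σ< n f = foldr-applyUpTo id n
  where
  foldr-applyUpTo : ∀ g n → foldr (λ p acc → f p + acc) 0ℚ (applyUpTo g n) ≡ Σ< n (f ∘ g)
  foldr-applyUpTo g zero    = refl
  foldr-applyUpTo g (suc n) = cong (f (g 0) +_) (foldr-applyUpTo (g ∘ suc) n)

Σ<-cong : ∀ n {f g} → (∀ i → f i ≡ g i) → Σ< n f ≡ Σ< n g
Σ<-cong zero    f≗g = refl
Σ<-cong (suc n) f≗g = cong₂ _+_ (f≗g 0) (Σ<-cong n (f≗g ∘ suc))

Σ<-zero : ∀ n {f} → (∀ i → f i ≡ 0ℚ) → Σ< n f ≡ 0ℚ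
Σ<-zero zero    f≗0 = refl
Σ<-zero (suc n) f≗0 = cong₂ _+_ (f≗0 0) (Σ<-zero n (f≗0 ∘ suc))

*-distribˡ-Σ< : ∀ n c f → c * Σ< n f ≡ Σ< n (λ i → c * f i)
*-distribˡ-Σ< zero    c f = ℚP.*-zeroʳ c
*-distribˡ-Σ< (suc n) c f =
  trans (ℚP.*-distribˡ-+ c (f 0) _) (cong (c * f 0 +_) (*-distribˡ-Σ< n c (f ∘ suc)))

Σ<-+ : ∀ n f g → Σ< n (λ i → f i + g i) ≡ Σ< n f + Σ< n g
Σ<-+ zero    f g = refl
Σ<-+ (suc n) f g = trans (cong (f 0 + g 0 +_) (Σ<-+ n (f ∘ suc) (g ∘ suc)))
  (solve 4 (λ a b x y → a :+ b :+ (x :+ y) := a :+ x :+ (b :+ y)) refl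
    (f 0) (g 0) (Σ< n (f ∘ suc)) (Σ< n (g ∘ suc)))

Σ<-last : ∀ n f → Σ< (suc n) f ≡ Σ< n f + f n
Σ<-last zero    f = ℚP.+-comm (f 0) 0ℚ
Σ<-last (suc n) f =
  trans (cong (f 0 +_) (Σ<-last n (f ∘ suc))) (sym (ℚP.+-assoc (f 0) (Σ< n (f ∘ suc)) (f (suc n))))

Σ<-reindex-suc : ∀ n f g → f 0 ≡ 0ℚ → g n ≡ 0ℚ → (∀ i → f (suc i) ≡ g i) →
                 Σ< (suc n) f ≡ Σ< (suc n) g
Σ<-reindex-suc n f g f0≡0 gn≡0 f∘suc≗g = begin
  f 0 + Σ< n (f ∘ suc)   ≡⟨ cong₂ _+_ f0≡0 (Σ<-cong n f∘suc≗g) ⟩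
  0ℚ + Σ< n g            ≡⟨ ℚP.+-identityˡ (Σ< n g) ⟩
  Σ< n g                 ≡⟨ ℚP.+-identityʳ (Σ< n g) ⟨
  Σ< n g + 0ℚ            ≡⟨ cong (Σ< n g +_) gn≡0 ⟨
  Σ< n g + g n           ≡⟨ Σ<-last n g ⟨
  Σ< (suc n) g           ∎
  where open ≡-Reasoning

coeff-+P : ∀ p q m → coeff (p +P q) m ≡ coeff p m + coeff q m
coeff-+P []      q       m       = sym (ℚP.+-identityˡ _)
coeff-+P (a ∷ p) []      m       = sym (ℚP.+-identityʳ _)
coeff-+P (a ∷ p) (b ∷ q) zero    = refl
coeff-+P (a ∷ p) (b ∷ q) (suc m) = coeff-+P p q m

coeff-scaleP : ∀ c p m → coeff (scaleP c p) m ≡ c * coeff p m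
coeff-scaleP c []      m       = sym (ℚP.*-zeroʳ c)
coeff-scaleP c (a ∷ p) zero    = refl
coeff-scaleP c (a ∷ p) (suc m) = coeff-scaleP c p m

mulLinear : ℚ → ℚ → (ℕ → ℚ) → ℕ → ℚ
mulLinear a b s zero    = a * s zero
mulLinear a b s (suc m) = a * s (suc m) + b * s m

mulLinear-cong : ∀ a b {s t} → (∀ m → s m ≡ t m) → ∀ m → mulLinear a b s m ≡ mulLinear a b t m
mulLinear-cong a b s≗t zero    = cong (a *_) (s≗t zero)
mulLinear-cong a b s≗t (suc m) = cong₂ (λ x y → a * x + b * y) (s≗t (suc m)) (s≗t m)

coeff-linear-*P : ∀ a b q m → coeff ((a ∷ b ∷ []) *P q) m ≡ mulLinear a b (coeff q) m
coeff-linear-*P a b q zero = begin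
  coeff (scaleP a q +P (0ℚ ∷ _)) 0   ≡⟨ coeff-+P (scaleP a q) _ 0 ⟩
  coeff (scaleP a q) 0 + 0ℚ          ≡⟨ ℚP.+-identityʳ _ ⟩
  coeff (scaleP a q) 0               ≡⟨ coeff-scaleP a q 0 ⟩
  a * coeff q 0                      ∎
  where open ≡-Reasoning
coeff-linear-*P a b q (suc m) = begin
  coeff (scaleP a q +P (0ℚ ∷ (scaleP b q +P (0ℚ ∷ [])))) (suc m)
    ≡⟨ coeff-+P (scaleP a q) _ (suc m) ⟩
  coeff (scaleP a q) (suc m) + coeff (scaleP b q +P (0ℚ ∷ [])) m
    ≡⟨ cong (coeff (scaleP a q) (suc m) +_) (coeff-+P (scaleP b q) (0ℚ ∷ []) m) ⟩
  coeff (scaleP a q) (suc m) + (coeff (scaleP b q) m + coeff (0ℚ ∷ []) m)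
    ≡⟨ cong₂ (λ x y → x + (y + coeff (0ℚ ∷ []) m)) (coeff-scaleP a q (suc m)) (coeff-scaleP b q m) ⟩
  a * coeff q (suc m) + (b * coeff q m + coeff (0ℚ ∷ []) m)
    ≡⟨ cong (λ z → a * coeff q (suc m) + (b * coeff q m + z)) (coeff-0ℚ∷[] m) ⟩
  a * coeff q (suc m) + (b * coeff q m + 0ℚ)
    ≡⟨ cong (a * coeff q (suc m) +_) (ℚP.+-identityʳ (b * coeff q m)) ⟩
  a * coeff q (suc m) + b * coeff q m ∎
  where
  open ≡-Reasoning
  coeff-0ℚ∷[] : ∀ m → coeff (0ℚ ∷ []) m ≡ 0ℚ
  coeff-0ℚ∷[] zero    = refl
  coeff-0ℚ∷[] (suc m) = refl

mulX+ : ℚ → (ℕ → ℚ) → ℕ → ℚ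
mulX+ a = mulLinear a 1ℚ

mulX+-zero-suc : ∀ s m → mulX+ 0ℚ s (suc m) ≡ s m
mulX+-zero-suc s m = solve 2 (λ x y → con 0ℚ :* x :+ con 1ℚ :* y := y) refl (s (suc m)) (s m)

mulX+-comm : ∀ a b s m → mulX+ a (mulX+ b s) m ≡ mulX+ b (mulX+ a s) m
mulX+-comm a b s zero = solve 3 (λ a b x → a :* (b :* x) := b :* (a :* x)) refl a b (s 0)
mulX+-comm a b s (suc zero) =
  solve 4 (λ a b x y → a :* (b :* y :+ con 1ℚ :* x) :+ con 1ℚ :* (b :* x)
                    := b :* (a :* y :+ con 1ℚ :* x) :+ con 1ℚ :* (a :* x))
    refl a b (s 0) (s 1)
mulX+-comm a b s (suc (suc m)) =
  solve 5 (λ a b x y z → a :* (b :* z :+ con 1ℚ :* y) :+ con 1ℚ :* (b :* y :+ con 1ℚ :* x)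
                      := b :* (a :* z :+ con 1ℚ :* y) :+ con 1ℚ :* (a :* y :+ con 1ℚ :* x))
    refl a b (s m) (s (suc m)) (s (suc (suc m)))

linearProduct : (ℕ → ℚ) → ℕ → ℕ → ℚ
linearProduct c zero    = coeff (constP 1ℚ)
linearProduct c (suc n) = mulX+ (c 0) (linearProduct (c ∘ suc) n)

coeff-prodP-linear : ∀ (h : ℕ → Poly) c → (∀ i → h i ≡ c i ∷ 1ℚ ∷ []) →
                     ∀ n m → coeff (prodP (applyUpTo h n)) m ≡ linearProduct c n m
coeff-prodP-linear h c h≡ zero    m = refl
coeff-prodP-linear h c h≡ (suc n) m = begin
  coeff (h 0 *P prodP (applyUpTo (h ∘ suc) n)) m
    ≡⟨ cong (λ f → coeff (f *P prodP (applyUpTo (h ∘ suc) n)) m) (h≡ 0) ⟩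
  coeff ((c 0 ∷ 1ℚ ∷ []) *P prodP (applyUpTo (h ∘ suc) n)) m
    ≡⟨ coeff-linear-*P (c 0) 1ℚ (prodP (applyUpTo (h ∘ suc) n)) m ⟩
  mulX+ (c 0) (coeff (prodP (applyUpTo (h ∘ suc) n))) m
    ≡⟨ mulLinear-cong (c 0) 1ℚ (coeff-prodP-linear (h ∘ suc) (c ∘ suc) (h≡ ∘ suc) n) m ⟩
  linearProduct c (suc n) m ∎
  where open ≡-Reasoning

linearProduct-snoc : ∀ c n m → linearProduct c (suc n) m ≡ mulX+ (c n) (linearProduct c n) m
linearProduct-snoc c zero    m = refl
linearProduct-snoc c (suc n) m =
  trans (mulLinear-cong (c 0) 1ℚ (linearProduct-snoc (c ∘ suc) n) m)
        (mulX+-comm (c 0) (c (suc n)) _ m)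

linearProduct-vanish : ∀ c n m → n < m → linearProduct c n m ≡ 0ℚ
linearProduct-vanish c zero    (suc m) _         = refl
linearProduct-vanish c (suc n) (suc m) (s≤s n<m) = begin
  c 0 * linearProduct (c ∘ suc) n (suc m) + 1ℚ * linearProduct (c ∘ suc) n m
    ≡⟨ cong₂ (λ x y → c 0 * x + 1ℚ * y)
         (linearProduct-vanish (c ∘ suc) n (suc m) (ℕP.m<n⇒m<1+n n<m))
         (linearProduct-vanish (c ∘ suc) n m n<m) ⟩
  c 0 * 0ℚ + 1ℚ * 0ℚ
    ≡⟨ solve 1 (λ x → x :* con 0ℚ :+ con 1ℚ :* con 0ℚ := con 0ℚ) refl (c 0) ⟩
  0ℚ ∎
  where open ≡-Reasoning

VanishesFrom : ℕ → (ℕ → ℚ) → Set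
VanishesFrom B s = ∀ m → B ≤ m → s m ≡ 0ℚ

taylorCoeff : ℚ → (ℕ → ℚ) → ℕ → ℕ → ℚ
taylorCoeff c s T j = Σ< T λ t → ℕ→ℚ ((j ℕ.+ t) C j) * c ^ℚ t * s (j ℕ.+ t)

taylorCoeff-cong : ∀ c {s s′} T j → (∀ m → s m ≡ s′ m) → taylorCoeff c s T j ≡ taylorCoeff c s′ T j
taylorCoeff-cong c T j s≗s′ = Σ<-cong T (λ t → cong (ℕ→ℚ ((j ℕ.+ t) C j) * c ^ℚ t *_) (s≗s′ (j ℕ.+ t)))

taylorCoeff-scale : ∀ c a s T j → taylorCoeff c (λ m → a * s m) T j ≡ a * taylorCoeff c s T j
taylorCoeff-scale c a s T j = trans (Σ<-cong T reassoc) (sym (*-distribˡ-Σ< T a _))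
  where
  reassoc : ∀ t → ℕ→ℚ ((j ℕ.+ t) C j) * c ^ℚ t * (a * s (j ℕ.+ t))
                ≡ a * (ℕ→ℚ ((j ℕ.+ t) C j) * c ^ℚ t * s (j ℕ.+ t))
  reassoc t = solve 4 (λ b x a y → b :* x :* (a :* y) := a :* (b :* x :* y)) refl
    (ℕ→ℚ ((j ℕ.+ t) C j)) (c ^ℚ t) a (s (j ℕ.+ t))

taylorCoeff-zero-suc : ∀ c s T → taylorCoeff c s (suc T) 0 ≡ s 0 + c * taylorCoeff c (s ∘ suc) T 0
taylorCoeff-zero-suc c s T =
  cong₂ _+_ (solve 1 (λ x → con 1ℚ :* con 1ℚ :* x := x) refl (s 0))
            (trans (Σ<-cong T reassoc) (sym (*-distribˡ-Σ< T c _)))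
  where
  reassoc : ∀ t → 1ℚ * (c * c ^ℚ t) * s (suc t) ≡ c * (1ℚ * c ^ℚ t * s (suc t))
  reassoc t = solve 3 (λ c x y → con 1ℚ :* (c :* x) :* y := c :* (con 1ℚ :* x :* y)) refl
    c (c ^ℚ t) (s (suc t))

taylorCoeff-suc-reindex : ∀ c s T j → VanishesFrom (j ℕ.+ T) s →
  Σ< T (λ t → ℕ→ℚ ((j ℕ.+ t) C suc j) * c ^ℚ t * s (j ℕ.+ t)) ≡ c * taylorCoeff c s T (suc j)
taylorCoeff-suc-reindex c s zero    j _   = sym (ℚP.*-zeroʳ c)
taylorCoeff-suc-reindex c s (suc T) j s≈0 =
  trans (Σ<-reindex-suc T g (λ t → c * h t) g0≡0 chT≡0 g∘suc≗ch) (sym (*-distribˡ-Σ< (suc T) c h))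
  where
  open ≡-Reasoning
  g h : ℕ → ℚ
  g t = ℕ→ℚ ((j ℕ.+ t) C suc j) * c ^ℚ t * s (j ℕ.+ t)
  h t = ℕ→ℚ ((suc j ℕ.+ t) C suc j) * c ^ℚ t * s (suc j ℕ.+ t)
  g0≡0 : g 0 ≡ 0ℚ
  g0≡0 = begin
    ℕ→ℚ ((j ℕ.+ 0) C suc j) * 1ℚ * s (j ℕ.+ 0)
      ≡⟨ cong (λ n → ℕ→ℚ n * 1ℚ * s (j ℕ.+ 0)) (k>n⇒nCk≡0 (s≤s (ℕP.≤-reflexive (ℕP.+-identityʳ j)))) ⟩
    0ℚ * 1ℚ * s (j ℕ.+ 0)
      ≡⟨ solve 1 (λ x → con 0ℚ :* con 1ℚ :* x := con 0ℚ) refl (s (j ℕ.+ 0)) ⟩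
    0ℚ ∎
  chT≡0 : c * h T ≡ 0ℚ
  chT≡0 = begin
    c * (ℕ→ℚ ((suc j ℕ.+ T) C suc j) * c ^ℚ T * s (suc j ℕ.+ T))
      ≡⟨ cong (λ y → c * (ℕ→ℚ ((suc j ℕ.+ T) C suc j) * c ^ℚ T * y))
           (s≈0 (suc j ℕ.+ T) (ℕP.≤-reflexive (ℕP.+-suc j T))) ⟩
    c * (ℕ→ℚ ((suc j ℕ.+ T) C suc j) * c ^ℚ T * 0ℚ)
      ≡⟨ solve 3 (λ c b x → c :* (b :* x :* con 0ℚ) := con 0ℚ) refl
           c (ℕ→ℚ ((suc j ℕ.+ T) C suc j)) (c ^ℚ T) ⟩
    0ℚ ∎
  g∘suc≗ch : ∀ t → g (suc t) ≡ c * h t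
  g∘suc≗ch t rewrite ℕP.+-suc j t =
    solve 4 (λ b c x y → b :* (c :* x) :* y := c :* (b :* x :* y)) refl
      (ℕ→ℚ (suc (j ℕ.+ t) C suc j)) c (c ^ℚ t) (s (suc (j ℕ.+ t)))

taylorCoeff-pascal : ∀ c s T j → VanishesFrom (j ℕ.+ T) (s ∘ suc) →
  taylorCoeff c s T (suc j) ≡ taylorCoeff c (s ∘ suc) T j + c * taylorCoeff c (s ∘ suc) T (suc j)
taylorCoeff-pascal c s T j s∘suc≈0 = begin
  taylorCoeff c s T (suc j)  ≡⟨ Σ<-cong T pascal ⟩
  Σ< T (λ t → f t + g t)     ≡⟨ Σ<-+ T f g ⟩
  Σ< T f + Σ< T g            ≡⟨ cong (Σ< T f +_) (taylorCoeff-suc-reindex c (s ∘ suc) T j s∘suc≈0) ⟩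
  Σ< T f + c * taylorCoeff c (s ∘ suc) T (suc j) ∎
  where
  open ≡-Reasoning
  f g : ℕ → ℚ
  f t = ℕ→ℚ ((j ℕ.+ t) C j) * c ^ℚ t * s (suc (j ℕ.+ t))
  g t = ℕ→ℚ ((j ℕ.+ t) C suc j) * c ^ℚ t * s (suc (j ℕ.+ t))
  pascal : ∀ t → ℕ→ℚ (suc (j ℕ.+ t) C suc j) * c ^ℚ t * s (suc (j ℕ.+ t)) ≡ f t + g t
  pascal t = begin
    ℕ→ℚ (suc (j ℕ.+ t) C suc j) * x * y
      ≡⟨ cong (λ n → ℕ→ℚ n * x * y) (nCk+nC[k+1]≡[n+1]C[k+1] (j ℕ.+ t) j) ⟨
    ℕ→ℚ ((j ℕ.+ t) C j ℕ.+ (j ℕ.+ t) C suc j) * x * y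
      ≡⟨ cong (λ z → z * x * y) (ℕ→ℚ-+ ((j ℕ.+ t) C j) ((j ℕ.+ t) C suc j)) ⟩
    (ℕ→ℚ ((j ℕ.+ t) C j) + ℕ→ℚ ((j ℕ.+ t) C suc j)) * x * y
      ≡⟨ solve 4 (λ a b x y → (a :+ b) :* x :* y := a :* x :* y :+ b :* x :* y) refl
           (ℕ→ℚ ((j ℕ.+ t) C j)) (ℕ→ℚ ((j ℕ.+ t) C suc j)) x y ⟩
    f t + g t ∎
    where
    x = c ^ℚ t
    y = s (suc (j ℕ.+ t))

coeff-compose-∷ : ∀ c a p m →
  coeff (compose (a ∷ p) (c ∷ 1ℚ ∷ [])) m
    ≡ coeff (constP a) m + mulX+ c (coeff (compose p (c ∷ 1ℚ ∷ []))) m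
coeff-compose-∷ c a p m = trans (coeff-+P (constP a) ((c ∷ 1ℚ ∷ []) *P compose p (c ∷ 1ℚ ∷ [])) m)
  (cong (coeff (constP a) m +_) (coeff-linear-*P c 1ℚ (compose p (c ∷ 1ℚ ∷ [])) m))

coeff-compose-c+X : ∀ c p j T → VanishesFrom (j ℕ.+ T) (coeff p) →
                   coeff (compose p (c ∷ 1ℚ ∷ [])) j ≡ taylorCoeff c (coeff p) T j
coeff-compose-c+X c []      j       T       _   =
  sym (Σ<-zero T (λ t → ℚP.*-zeroʳ (ℕ→ℚ ((j ℕ.+ t) C j) * c ^ℚ t)))
coeff-compose-c+X c (a ∷ p) zero    zero    p≈0 = begin
  coeff (compose (a ∷ p) q) 0
    ≡⟨ coeff-compose-∷ c a p 0 ⟩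
  a + c * coeff (compose p q) 0
    ≡⟨ cong₂ (λ x y → x + c * y) (p≈0 0 z≤n) (coeff-compose-c+X c p 0 0 (λ m _ → p≈0 (suc m) z≤n)) ⟩
  0ℚ + c * 0ℚ
    ≡⟨ solve 1 (λ c → con 0ℚ :+ c :* con 0ℚ := con 0ℚ) refl c ⟩
  0ℚ ∎
  where
  open ≡-Reasoning
  q = c ∷ 1ℚ ∷ []
coeff-compose-c+X c (a ∷ p) zero    (suc T) p≈0 = begin
  coeff (compose (a ∷ p) q) 0
    ≡⟨ coeff-compose-∷ c a p 0 ⟩
  a + c * coeff (compose p q) 0
    ≡⟨ cong (λ y → a + c * y) (coeff-compose-c+X c p 0 T (λ m → p≈0 (suc m) ∘ s≤s)) ⟩
  a + c * taylorCoeff c (coeff p) T 0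
    ≡⟨ taylorCoeff-zero-suc c (coeff (a ∷ p)) T ⟨
  taylorCoeff c (coeff (a ∷ p)) (suc T) 0 ∎
  where
  open ≡-Reasoning
  q = c ∷ 1ℚ ∷ []
coeff-compose-c+X c (a ∷ p) (suc j) T       p≈0 = begin
  coeff (compose (a ∷ p) q) (suc j)
    ≡⟨ coeff-compose-∷ c a p (suc j) ⟩
  0ℚ + (c * coeff (compose p q) (suc j) + 1ℚ * coeff (compose p q) j)
    ≡⟨ cong₂ (λ x y → 0ℚ + (c * x + 1ℚ * y))
         (coeff-compose-c+X c p (suc j) T (λ m → p≈0 (suc m) ∘ ℕP.m≤n⇒m≤1+n))
         (coeff-compose-c+X c p j T tail≈0) ⟩
  0ℚ + (c * τ (suc j) + 1ℚ * τ j)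
    ≡⟨ solve 3 (λ c x y → con 0ℚ :+ (c :* x :+ con 1ℚ :* y) := y :+ c :* x) refl c (τ (suc j)) (τ j) ⟩
  τ j + c * τ (suc j)
    ≡⟨ taylorCoeff-pascal c (coeff (a ∷ p)) T j tail≈0 ⟨
  taylorCoeff c (coeff (a ∷ p)) T (suc j) ∎
  where
  open ≡-Reasoning
  q = c ∷ 1ℚ ∷ []
  τ = taylorCoeff c (coeff p) T
  tail≈0 : VanishesFrom (j ℕ.+ T) (coeff p)
  tail≈0 m = p≈0 (suc m) ∘ s≤s

coeff-risingPoly : ∀ n m → coeff (risingPoly n) m ≡ linearProduct ℕ→ℚ n m
coeff-risingPoly n m = trans (cong (λ fs → coeff (prodP fs) m) (map-upTo _ n))
  (coeff-prodP-linear _ ℕ→ℚ (λ i → cong (_∷ 1ℚ ∷ []) (ℚP.+-identityʳ (ℕ→ℚ i))) n m)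

risingPoly₁ : ℕ → Poly
risingPoly₁ n = prodP (map (λ i → X +P constP (ℕ→ℚ (suc i))) (upTo n))

coeff-risingPoly₁ : ∀ n m → coeff (risingPoly₁ n) m ≡ linearProduct (ℕ→ℚ ∘ suc) n m
coeff-risingPoly₁ n m = trans (cong (λ fs → coeff (prodP fs) m) (map-upTo _ n))
  (coeff-prodP-linear _ (ℕ→ℚ ∘ suc) (λ i → cong (_∷ 1ℚ ∷ []) (ℚP.+-identityˡ (ℕ→ℚ (suc i)))) n m)

numeratorPoly : ℕ → Poly
numeratorPoly n = (scaleP (ℕ→ℚ 2) X +P constP (ℕ→ℚ (suc n))) *P risingPoly₁ n

coeff-numeratorPoly : ∀ n m →
  coeff (numeratorPoly n) m ≡ coeff (risingPoly (suc (suc n))) (suc m) + coeff (risingPoly (suc n)) m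
coeff-numeratorPoly n m = begin
  coeff (numeratorPoly n) m
    ≡⟨ coeff-linear-*P a b (risingPoly₁ n) m ⟩
  mulLinear a b (coeff (risingPoly₁ n)) m
    ≡⟨ mulLinear-cong a b (coeff-risingPoly₁ n) m ⟩
  mulLinear a b G m
    ≡⟨ split m ⟩
  mulX+ (ℕ→ℚ (suc n)) G m + mulX+ 0ℚ G m
    ≡⟨ cong (_+ mulX+ 0ℚ G m) (linearProduct-snoc (ℕ→ℚ ∘ suc) n m) ⟨
  G′ m + mulX+ 0ℚ G m
    ≡⟨ cong₂ _+_ (trans (coeff-risingPoly (suc (suc n)) (suc m)) (mulX+-zero-suc G′ m))
                 (coeff-risingPoly (suc n) m) ⟨
  coeff (risingPoly (suc (suc n))) (suc m) + coeff (risingPoly (suc n)) m ∎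
  where
  open ≡-Reasoning
  a b : ℚ
  a = ℕ→ℚ 2 * 0ℚ + ℕ→ℚ (suc n)
  b = ℕ→ℚ 2 * 1ℚ
  G G′ : ℕ → ℚ
  G = linearProduct (ℕ→ℚ ∘ suc) n
  G′ = linearProduct (ℕ→ℚ ∘ suc) (suc n)
  split : ∀ m → mulLinear a b G m ≡ mulX+ (ℕ→ℚ (suc n)) G m + mulX+ 0ℚ G m
  split zero    = solve 2 (λ k x → (con (ℕ→ℚ 2) :* con 0ℚ :+ k) :* x := k :* x :+ con 0ℚ :* x)
                    refl (ℕ→ℚ (suc n)) (G 0)
  split (suc m) = solve 3 (λ k x y → (con (ℕ→ℚ 2) :* con 0ℚ :+ k) :* y :+ con (ℕ→ℚ 2) :* con 1ℚ :* x
                                   := (k :* y :+ con 1ℚ :* x) :+ (con 0ℚ :* y :+ con 1ℚ :* x))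
                    refl (ℕ→ℚ (suc n)) (G m) (G (suc m))

numeratorPoly-vanish : ∀ n → VanishesFrom (suc (suc n)) (coeff (numeratorPoly n))
numeratorPoly-vanish n m n+2≤m = begin
  coeff (numeratorPoly n) m
    ≡⟨ coeff-numeratorPoly n m ⟩
  coeff (risingPoly (suc (suc n))) (suc m) + coeff (risingPoly (suc n)) m
    ≡⟨ cong₂ _+_ (trans (coeff-risingPoly (suc (suc n)) (suc m)) (linearProduct-vanish ℕ→ℚ _ _ (s≤s n+2≤m)))
                 (trans (coeff-risingPoly (suc n) m) (linearProduct-vanish ℕ→ℚ _ _ n+2≤m)) ⟩
  0ℚ + 0ℚ
    ≡⟨ ℚP.+-identityʳ 0ℚ ⟩
  0ℚ ∎
  where open ≡-Reasoning

shiftedNumeratorCoeff : ℕ → ℕ → ℚ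
shiftedNumeratorCoeff n j =
  taylorCoeff (0ℚ + - half (suc (suc n))) (coeff (numeratorPoly n)) (suc (suc n) ∸ j) j

Ccoef≡shiftedNumeratorCoeff : ∀ n j → j < suc (suc n) → Ccoef (suc (suc n)) j ≡ shiftedNumeratorCoeff n j
Ccoef≡shiftedNumeratorCoeff n j j<k = begin
  -- Pk (2 + n) unfolds to scaleP ι (numeratorPoly n)
  ℕ→ℚ (suc n !) * coeff (compose (scaleP ι N) (c ∷ 1ℚ ∷ [])) j
    ≡⟨ cong (ℕ→ℚ (suc n !) *_) (coeff-compose-c+X c (scaleP ι N) j T ιN≈0) ⟩
  ℕ→ℚ (suc n !) * taylorCoeff c (coeff (scaleP ι N)) T j
    ≡⟨ cong (ℕ→ℚ (suc n !) *_) (trans (taylorCoeff-cong c T j (coeff-scaleP ι N))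
                                       (taylorCoeff-scale c ι (coeff N) T j)) ⟩
  ℕ→ℚ (suc n !) * (ι * τ)  ≡⟨ ℚP.*-assoc (ℕ→ℚ (suc n !)) ι τ ⟨
  ℕ→ℚ (suc n !) * ι * τ    ≡⟨ cong (_* τ) (ℕ→ℚ-*-inverse (suc n !) {{suc n ℕP.!≢0}}) ⟩
  1ℚ * τ                   ≡⟨ ℚP.*-identityˡ τ ⟩
  τ                        ∎
  where
  open ≡-Reasoning
  N = numeratorPoly n
  T = suc (suc n) ∸ j
  c = 0ℚ + - half (suc (suc n))
  ι = (pos 1 / suc n !) {{suc n ℕP.!≢0}}
  τ = shiftedNumeratorCoeff n j
  ιN≈0 : VanishesFrom (j ℕ.+ T) (coeff (scaleP ι N))
  ιN≈0 m j+T≤m = begin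
    coeff (scaleP ι N) m ≡⟨ coeff-scaleP ι N m ⟩
    ι * coeff N m        ≡⟨ cong (ι *_) (numeratorPoly-vanish n m k≤m) ⟩
    ι * 0ℚ               ≡⟨ ℚP.*-zeroʳ ι ⟩
    0ℚ                   ∎
    where k≤m = subst (_≤ m) (ℕP.m+[n∸m]≡n (ℕP.<⇒≤ j<k)) j+T≤m

Bcoef-summand : ∀ n j t →
  let k = suc (suc n) in
  negOnePow (k ℕ.+ j ℕ.+ 1) * ℕ→ℚ ((j ℕ.+ t) C j) * half k ^ℚ t
    * (stirling1 k (j ℕ.+ t ℕ.+ 1) + stirling1 (suc n) (j ℕ.+ t))
  ≡ ℕ→ℚ ((j ℕ.+ t) C j) * (0ℚ + - half k) ^ℚ t * coeff (numeratorPoly n) (j ℕ.+ t)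
Bcoef-summand n j t = begin
  negOnePow e * β * h ^ℚ t
    * (negOnePow (k ℕ.+ (j ℕ.+ t ℕ.+ 1)) * r₁ + negOnePow (suc n ℕ.+ (j ℕ.+ t)) * r₀)
    ≡⟨ cong₂ (λ u v → negOnePow e * β * h ^ℚ t * (u * r₁ + v * r₀)) sign₁ sign₀ ⟩
  negOnePow e * β * h ^ℚ t * (σ * r₁ + σ * r₀)
    ≡⟨ solve 6 (λ ε β x σ y z → ε :* β :* x :* (σ :* y :+ σ :* z) := β :* (ε :* σ :* x) :* (y :+ z))
         refl (negOnePow e) β (h ^ℚ t) σ r₁ r₀ ⟩
  β * (negOnePow e * σ * h ^ℚ t) * (r₁ + r₀)
    ≡⟨ cong (λ u → β * (u * h ^ℚ t) * (r₁ + r₀)) (negOnePow-cancelˡ e t) ⟩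
  β * (negOnePow t * h ^ℚ t) * (r₁ + r₀)
    ≡⟨ cong₂ (λ u v → β * u * v) power (sym numerator) ⟩
  β * (0ℚ + - h) ^ℚ t * coeff (numeratorPoly n) (j ℕ.+ t) ∎
  where
  open ≡-Reasoning
  k = suc (suc n)
  e = k ℕ.+ j ℕ.+ 1
  h = half k
  β = ℕ→ℚ ((j ℕ.+ t) C j)
  σ = negOnePow (e ℕ.+ t)
  r₁ = coeff (risingPoly k) (j ℕ.+ t ℕ.+ 1)
  r₀ = coeff (risingPoly (suc n)) (j ℕ.+ t)
  index₁ : ∀ a b d → suc (suc a) ℕ.+ (b ℕ.+ d ℕ.+ 1) ≡ suc (suc a) ℕ.+ b ℕ.+ 1 ℕ.+ d
  index₁ = solve-∀
  index₀ : ∀ a b d → suc (suc (suc a ℕ.+ (b ℕ.+ d))) ≡ suc (suc a) ℕ.+ b ℕ.+ 1 ℕ.+ d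
  index₀ = solve-∀
  sign₁ : negOnePow (k ℕ.+ (j ℕ.+ t ℕ.+ 1)) ≡ σ
  sign₁ = cong negOnePow (index₁ n j t)
  sign₀ : negOnePow (suc n ℕ.+ (j ℕ.+ t)) ≡ σ
  sign₀ = trans (sym (negOnePow-suc-suc (suc n ℕ.+ (j ℕ.+ t)))) (cong negOnePow (index₀ n j t))
  power : negOnePow t * h ^ℚ t ≡ (0ℚ + - h) ^ℚ t
  power = sym (trans (cong (_^ℚ t) (ℚP.+-identityˡ (- h))) (-‿^ℚ h t))
  numerator : coeff (numeratorPoly n) (j ℕ.+ t) ≡ r₁ + r₀
  numerator = trans (coeff-numeratorPoly n (j ℕ.+ t))
                    (cong (λ i → coeff (risingPoly k) i + r₀) (ℕP.+-comm 1 (j ℕ.+ t)))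

Bcoef≡shiftedNumeratorCoeff : ∀ n j → Bcoef (suc (suc n)) j ≡ shiftedNumeratorCoeff n j
Bcoef≡shiftedNumeratorCoeff n j =
  trans (sumRange≡Σ< (suc (suc n) ∸ j) _) (Σ<-cong (suc (suc n) ∸ j) (Bcoef-summand n j))

theorem4 : (k : ℕ) → 2 ≤ k → (j : ℕ) → j < k → Ccoef k j ≡ Bcoef k j
theorem4 (suc (suc n)) (s≤s (s≤s z≤n)) j j<k =
  trans (Ccoef≡shiftedNumeratorCoeff n j j<k) (sym (Bcoef≡shiftedNumeratorCoeff n j))
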